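{- Let $\mathbb{I}$ be the icosahedron graph. Then $k(\mathbb{I})\le 4$.
   Context: All graphs are simple and undirected. The icosahedron graph $\mathbb{I}$ is the graph formed by the $12$ vertices and $30$ edges of a regular icosahedron. The competition graph $C(D)$ of a digraph $D$ is the graph with vertex set $V(D)$ in which two distinct vertices $x,y$ are adjacent if and only if there is a vertex $v$ with $(x,v)$ and $(y,v)$ both arcs of $D$. The competition number $k(G)$ of a graph $G$ is the minimum integer $k\ge 0$ such that $G$ together with $k$ new isolated vertices is the competition graph of some acyclic digraph. -}

module Defs where

open import Data.Nat using (ℕ; zero; suc; _+_; _≤_)
open import Data.Fin using (Fin; toℕ; splitAt)
open import Data.Product using (_×_; _,_; ∃-syntax; Σ-syntax)
open import Data.Sum using (_⊎_; inj₁; inj₂)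
open import Data.Empty using (⊥)
open import Data.List using (List; []; _∷_)
open import Data.List.Membership.Propositional using (_∈_)
open import Relation.Nullary using (¬_)
open import Relation.Binary.PropositionalEquality using (_≡_; _≢_)
open import Relation.Binary.Construct.Closure.Transitive using (TransClosure)
open import Function.Bundles using (_⇔_)

record Graph (n : ℕ) : Set₁ where
  field
    Adj   : Fin n → Fin n → Set
    sym   : ∀ {x y} → Adj x y → Adj y x
    irrefl : ∀ {x} → ¬ Adj x x
open Graph public

Digraph : ℕ → Set₁
Digraph m = Fin m → Fin m → Set

Acyclic : ∀ {m} → Digraph m → Set
Acyclic D = ∀ x → ¬ TransClosure D x x

CompAdj : ∀ {m} → Digraph m → Fin m → Fin m → Set
CompAdj D x y = (x ≢ y) × (∃[ v ] (D x v × D y v))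

-- Adjacency of G together with k new isolated vertices
-- (old vertices are Fin n ↑ˡ k, new ones n ↑ʳ Fin k).
AddIsoAdj : ∀ {n} → Graph n → (k : ℕ) → Fin (n + k) → Fin (n + k) → Set
AddIsoAdj {n} G k x y with splitAt n x | splitAt n y
... | inj₁ x' | inj₁ y' = Adj G x' y'
... | _       | _       = ⊥

CompWithIsolated : ∀ {n} → Graph n → ℕ → Set₁
CompWithIsolated {n} G k =
  Σ[ D ∈ Digraph (n + k) ] (Acyclic D ×
    (∀ x y → AddIsoAdj G k x y ⇔ CompAdj D x y))

-- k(G) ≤ b : the minimum k with CompWithIsolated G k is at most b,
-- i.e. some k ≤ b works.
CompetitionNumber≤ : ∀ {n} → Graph n → ℕ → Set₁
CompetitionNumber≤ G b = Σ[ k ∈ ℕ ] (k ≤ b × CompWithIsolated G k)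

-- Icosahedron: vertex 0 = top, 1..5 upper pentagon, 6..10 lower
-- pentagon, 11 = bottom.  Upper i is joined to lower 5+i and 5+(i mod 5)+1.
icoEdges : List (ℕ × ℕ)
icoEdges =
  (0 , 1) ∷ (0 , 2) ∷ (0 , 3) ∷ (0 , 4) ∷ (0 , 5) ∷
  (1 , 2) ∷ (2 , 3) ∷ (3 , 4) ∷ (4 , 5) ∷ (5 , 1) ∷
  (1 , 6) ∷ (1 , 7) ∷ (2 , 7) ∷ (2 , 8) ∷ (3 , 8) ∷
  (3 , 9) ∷ (4 , 9) ∷ (4 , 10) ∷ (5 , 10) ∷ (5 , 6) ∷
  (6 , 7) ∷ (7 , 8) ∷ (8 , 9) ∷ (9 , 10) ∷ (10 , 6) ∷
  (11 , 6) ∷ (11 , 7) ∷ (11 , 8) ∷ (11 , 9) ∷ (11 , 10) ∷ []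

icoAdj : Fin 12 → Fin 12 → Set
icoAdj x y = ((toℕ x , toℕ y) ∈ icoEdges) ⊎ ((toℕ y , toℕ x) ∈ icoEdges)

private
  icoSym : ∀ {x y} → icoAdj x y → icoAdj y x
  icoSym (inj₁ p) = inj₂ p
  icoSym (inj₂ p) = inj₁ p

  open import Data.List.Relation.Unary.Any using (here; there)
  open import Relation.Binary.PropositionalEquality using (refl)

  noLoop : ∀ a → ¬ ((a , a) ∈ icoEdges)
  noLoop a (here ())
  noLoop a (there (here ()))
  noLoop a (there (there (here ())))
  noLoop a (there (there (there (here ()))))
  noLoop a (there (there (there (there (here ())))))
  noLoop a (there (there (there (there (there p))))) = nl5 p
    where
    nl5 : ¬ ((a , a) ∈ _)
    nl5 (here ())
    nl5 (there (here ()))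
    nl5 (there (there (here ())))
    nl5 (there (there (there (here ()))))
    nl5 (there (there (there (there (here ())))))
    nl5 (there (there (there (there (there q))))) = nl10 q
      where
      nl10 : ¬ ((a , a) ∈ _)
      nl10 (here ())
      nl10 (there (here ()))
      nl10 (there (there (here ())))
      nl10 (there (there (there (here ()))))
      nl10 (there (there (there (there (here ())))))
      nl10 (there (there (there (there (there r))))) = nl15 r
        where
        nl15 : ¬ ((a , a) ∈ _)
        nl15 (here ())
        nl15 (there (here ()))
        nl15 (there (there (here ())))
        nl15 (there (there (there (here ()))))
        nl15 (there (there (there (there (here ())))))
        nl15 (there (there (there (there (there s))))) = nl20 s
          where
          nl20 : ¬ ((a , a) ∈ _)
          nl20 (here ())
          nl20 (there (here ()))
          nl20 (there (there (here ())))
          nl20 (there (there (there (here ()))))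
          nl20 (there (there (there (there (here ())))))
          nl20 (there (there (there (there (there t))))) = nl25 t
            where
            nl25 : ¬ ((a , a) ∈ _)
            nl25 (here ())
            nl25 (there (here ()))
            nl25 (there (there (here ())))
            nl25 (there (there (there (here ()))))
            nl25 (there (there (there (there (here ())))))
            nl25 (there (there (there (there (there ())))))

  icoIrrefl : ∀ {x} → ¬ icoAdj x x
  icoIrrefl {x} (inj₁ p) = noLoop (toℕ x) p
  icoIrrefl {x} (inj₂ p) = noLoop (toℕ x) p

Icosahedron : Graph 12
Icosahedron = record { Adj = icoAdj ; sym = icoSym ; irrefl = icoIrrefl }

-- Thirteen triangles of 𝕀 cover all 30 of its edges.  Give each triangle its
-- own sink, chosen above all three of its vertices in the vertex order: the
-- nine vertices 3, …, 11 of 𝕀 and the four added vertices.  Every arc then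
-- goes upwards, so the digraph is acyclic, and two vertices compete exactly
-- when they share a triangle, i.e. when they are adjacent in 𝕀.

module Submission where

open import Defs
open import Data.Nat using (ℕ; _<_; _<?_)
import Data.Nat as ℕ
open import Data.Nat.Properties using (≤-refl; <-trans; <-irrefl)
open import Data.Fin using (Fin; toℕ; splitAt)
import Data.Fin as Fin
open import Data.Fin.Properties using (any?; all?)
open import Data.Product using (_,_; uncurry)
open import Data.Product.Properties using (≡-dec)
open import Data.Sum using (inj₁; inj₂)
open import Data.Unit using (tt)
open import Data.List using (List; []; _∷_)
open import Data.List.Membership.Propositional using (_∈_)
open import Data.List.Membership.DecPropositional ℕ._≟_ using (_∈?_)
import Data.List.Membership.DecPropositional as DecMembership
open import Relation.Nullary using (Dec; no; ¬?)
open import Relation.Nullary.Decidable using (_⊎-dec_; _×-dec_; _→-dec_; map′; toWitness)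
open import Relation.Binary.PropositionalEquality using (refl)
open import Relation.Binary.Construct.Closure.Transitive using (TransClosure; [_]; _∷_)
open import Function.Bundles using (_⇔_; mk⇔; Equivalence)

_⇔-dec_ : ∀ {A B : Set} → Dec A → Dec B → Dec (A ⇔ B)
a? ⇔-dec b? = map′ (uncurry mk⇔) (λ e → Equivalence.to e , Equivalence.from e)
                   ((a? →-dec b?) ×-dec (b? →-dec a?))

rank-increasing⇒acyclic : ∀ {m} {D : Digraph m} (rank : Fin m → ℕ) →
                          (∀ {x y} → D x y → rank x < rank y) → Acyclic D
rank-increasing⇒acyclic {D = D} rank arc< x cycle = <-irrefl refl (path< cycle)
  where
  path< : ∀ {x y} → TransClosure D x y → rank x < rank y
  path< [ p ]    = arc< p
  path< (p ∷ ps) = <-trans (arc< p) (path< ps)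

compAdj? : ∀ {m} {D : Digraph m} → (∀ x v → Dec (D x v)) →
           ∀ x y → Dec (CompAdj D x y)
compAdj? D? x y = ¬? (x Fin.≟ y) ×-dec any? (λ v → D? x v ×-dec D? y v)

addIsoAdj? : ∀ {n} {G : Graph n} → (∀ x y → Dec (Adj G x y)) →
             ∀ k x y → Dec (AddIsoAdj G k x y)
addIsoAdj? {n} adj? k x y with splitAt n x | splitAt n y
... | inj₁ x′ | inj₁ y′ = adj? x′ y′
... | inj₁ _  | inj₂ _  = no λ ()
... | inj₂ _  | inj₁ _  = no λ ()
... | inj₂ _  | inj₂ _  = no λ ()

icoAdj? : ∀ x y → Dec (Adj Icosahedron x y)
icoAdj? x y = ((toℕ x , toℕ y) ∈ₑ? icoEdges) ⊎-dec ((toℕ y , toℕ x) ∈ₑ? icoEdges)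
  where open DecMembership (≡-dec ℕ._≟_ ℕ._≟_) renaming (_∈?_ to _∈ₑ?_)

-- The in-neighbourhood of each vertex; 12–15 are the four added vertices.
prey : ℕ → List ℕ
prey 3  = 0 ∷ 1 ∷ 2 ∷ []
prey 4  = 0 ∷ 2 ∷ 3 ∷ []
prey 5  = 0 ∷ 3 ∷ 4 ∷ []
prey 6  = 0 ∷ 1 ∷ 5 ∷ []
prey 7  = 1 ∷ 5 ∷ 6 ∷ []
prey 8  = 1 ∷ 2 ∷ 7 ∷ []
prey 9  = 2 ∷ 7 ∷ 8 ∷ []
prey 10 = 3 ∷ 8 ∷ 9 ∷ []
prey 11 = 4 ∷ 5 ∷ 10 ∷ []
prey 12 = 6 ∷ 7 ∷ 11 ∷ []
prey 13 = 4 ∷ 9 ∷ 10 ∷ []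
prey 14 = 6 ∷ 10 ∷ 11 ∷ []
prey 15 = 8 ∷ 9 ∷ 11 ∷ []
prey _  = []

foodWeb : Digraph 16
foodWeb x v = toℕ x ∈ prey (toℕ v)

foodWeb? : ∀ x v → Dec (foodWeb x v)
foodWeb? x v = toℕ x ∈? prey (toℕ v)

foodWeb-increasing : ∀ {x v} → foodWeb x v → toℕ x < toℕ v
foodWeb-increasing {x} {v} = toWitness {a? = all? λ x → all? λ v →
  foodWeb? x v →-dec (toℕ x <? toℕ v)} tt x v

foodWeb-acyclic : Acyclic foodWeb
foodWeb-acyclic = rank-increasing⇒acyclic toℕ foodWeb-increasing

competition-foodWeb : ∀ x y → AddIsoAdj Icosahedron 4 x y ⇔ CompAdj foodWeb x y
competition-foodWeb = toWitness {a? = all? λ x → all? λ y →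
  addIsoAdj? icoAdj? 4 x y ⇔-dec compAdj? foodWeb? x y} tt

lemma3p3 : CompetitionNumber≤ Icosahedron 4
lemma3p3 = 4 , ≤-refl , foodWeb , foodWeb-acyclic , competition-foodWeb
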